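{- Let $r$ be a complex number and $n\ge1$ an integer. Then, as polynomials in $x$, $$\sum_{k=0}^{n-1}(2k+2r+1)\prod_{s=k+1}^n s(s+2r)\, D_k^{(r)}(x)^2 =n(n+2r)\big(D_n^{(r)}(x)^2-D_{n-1}^{(r)}(x)D_{n+1}^{(r)}(x)\big).$$ Consequently, if $r>-\tfrac12$ is real, then $D_n^{(r)}(x)^2-D_{n+1}^{(r)}(x)D_{n-1}^{(r)}(x)>0$ for every real $x$.
   Context: For a parameter $r$, the polynomials $D_n^{(r)}(x)$ are defined by $D_{ -1}^{(r)}(x)=0$, $D_0^{(r)}(x)=1$ and $D_{n+1}^{(r)}(x)=xD_n^{(r)}(x)-n(n+2r)D_{n-1}^{(r)}(x)$ for $n\ge0$. -}

module Defs where

open import Level using (Level; _⊔_)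
open import Data.Nat as ℕ using (ℕ; zero; suc; _∸_)
open import Data.Product using (_×_; _,_; proj₁; proj₂)
open import Algebra.Bundles using (CommutativeRing)
open import Relation.Binary.Core using (Rel)
open import Relation.Binary.Structures using (IsStrictTotalOrder)

-- The polynomials D_n^{(r)}(x), evaluated in an arbitrary commutative ring
-- (r and x are ring elements).  Taking R = ℂ[x] (or ℂ) recovers the paper's setting.
module DPoly {c ℓ : Level} (R : CommutativeRing c ℓ) where
  open CommutativeRing R

  ι : ℕ → Carrier
  ι zero    = 0#
  ι (suc n) = 1# + ι n

  -- Dpair r x n = ( D_{n-1}^{(r)}(x) , D_n^{(r)}(x) )
  Dpair : Carrier → Carrier → ℕ → Carrier × Carrier
  Dpair r x zero    = 0# , 1#
  Dpair r x (suc n) with Dpair r x n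
  ... | (a , b) = b , (x * b - (ι n * (ι n + (r + r))) * a)

  -- D r x n = D_n^{(r)}(x)   (D_{-1} = 0, D_0 = 1,
  --   D_{n+1} = x D_n - n(n+2r) D_{n-1})
  D : Carrier → Carrier → ℕ → Carrier
  D r x n = proj₂ (Dpair r x n)

  sumTo : ℕ → (ℕ → Carrier) → Carrier
  sumTo zero    f = 0#
  sumTo (suc n) f = sumTo n f + f n

  prodFrom : ℕ → ℕ → (ℕ → Carrier) → Carrier
  prodFrom a zero    g = 1#
  prodFrom a (suc m) g = g (suc a) * prodFrom (suc a) m g

  -- ∏_{s=k+1}^{n} g s   (empty product = 1 when n ≤ k)
  prodIoc : ℕ → ℕ → (ℕ → Carrier) → Carrier
  prodIoc k n g = prodFrom k (n ∸ k) g

record IsOrderedCommRing {c ℓ ℓ' : Level} (R : CommutativeRing c ℓ)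
         (_<_ : Rel (CommutativeRing.Carrier R) ℓ') : Set (c ⊔ ℓ ⊔ ℓ') where
  open CommutativeRing R
  field
    isStrictTotalOrder : IsStrictTotalOrder _≈_ _<_
    0<1                : 0# < 1#
    +-monoˡ-<          : ∀ {a b} (d : Carrier) → a < b → (a + d) < (b + d)
    *-pos              : ∀ {a b} → 0# < a → 0# < b → 0# < (a * b)

{-# OPTIONS --safe #-}
module Submission where

-- With γ n = n(n+2r) one has γ (n+1) − γ n = 2n+2r+1, and the three-term recurrence turns
-- Turán's expression T n = D_n² − D_{n−1} D_{n+1} into
--   T (n+1) = (2n+2r+1) D_n² + γ n · T n.
-- Unrolling this from γ 0 = 0 gives the identity. When 2r+1 > 0 the coefficients 2n+2r+1 and
-- γ (n+1) are positive, so T (n+1) > 0 follows by induction from T 1 = 2r+1.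

open import Level using (Level)
open import Data.Nat as ℕ using (ℕ; zero; suc; _∸_; _≤_)
import Data.Nat.Properties as ℕP
open import Data.Product using (_×_; _,_; proj₁)
open import Data.Sum using (inj₁; inj₂)
open import Algebra.Bundles using (CommutativeRing)
open import Relation.Binary.Core using (Rel)
open import Relation.Binary.Definitions using (tri<; tri≈; tri>)
import Relation.Binary.Construct.StrictToNonStrict as StrictToNonStrict
open import Relation.Binary.Structures using (module IsStrictTotalOrder)
import Relation.Binary.PropositionalEquality as P

open import Defs

module CommutativeRingProperties {c ℓ} (R : CommutativeRing c ℓ) where
  open CommutativeRing R
  open DPoly R
  open import Algebra.Properties.Ring ring using (//-rightDividesˡ; +-cancelʳ; x[y-z]≈xy-xz)
  open import Algebra.Solver.Ring.NaturalCoefficients.Default commutativeSemiring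
  open import Relation.Binary.Reasoning.Setoid setoid

  ι-+ : ∀ m n → ι (m ℕ.+ n) ≈ ι m + ι n
  ι-+ zero    n = sym (+-identityˡ (ι n))
  ι-+ (suc m) n = trans (+-congˡ (ι-+ m n)) (sym (+-assoc 1# (ι m) (ι n)))

  ι-2* : ∀ n → ι (2 ℕ.* n) ≈ ι n + ι n
  ι-2* n = trans (ι-+ n (n ℕ.+ 0)) (+-congˡ (reflexive (P.cong ι (ℕP.+-identityʳ n))))

  x-y+[y+z]≈x+z : ∀ u v t → (u - v) + (v + t) ≈ u + t
  x-y+[y+z]≈x+z u v t = trans (sym (+-assoc (u - v) v t)) (+-congʳ (//-rightDividesˡ v u))

  x+w≈z+y⇒x-y≈z-w : ∀ {u v s t} → u + t ≈ s + v → u - v ≈ s - t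
  x+w≈z+y⇒x-y≈z-w {u} {v} {s} {t} u+t≈s+v = +-cancelʳ (v + t) (u - v) (s - t) (begin
    (u - v) + (v + t) ≈⟨ x-y+[y+z]≈x+z u v t ⟩
    u + t             ≈⟨ u+t≈s+v ⟩
    s + v             ≈⟨ x-y+[y+z]≈x+z s t v ⟨
    (s - t) + (t + v) ≈⟨ +-congˡ (+-comm t v) ⟩
    (s - t) + (v + t) ∎)

  -- Turán's expression for any sequence  b_{n+1} = x b_n - g_n b_{n-1}  with  g_{n+1} = g_n + w_n:
  -- here a, b, b', b'' stand for b_{n-1}, b_n, b_{n+1}, b_{n+2}.
  turán-step : ∀ {x a b b' b'' g g' w} → b' + g * a ≈ x * b → b'' + g' * b ≈ x * b' → g' ≈ g + w →
    b' * b' - b * b'' ≈ w * (b * b) + g * (b * b - a * b')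
  turán-step {x} {a} {b} {b'} {b''} {g} {g'} {w} b'-rec b''-rec g'≈g+w = begin
    b' * b' - b * b''                          ≈⟨ x+w≈z+y⇒x-y≈z-w cross ⟩
    (w * (b * b) + g * (b * b)) - g * (a * b') ≈⟨ +-assoc _ _ _ ⟩
    w * (b * b) + (g * (b * b) - g * (a * b')) ≈⟨ +-congˡ (x[y-z]≈xy-xz g (b * b) (a * b')) ⟨
    w * (b * b) + g * (b * b - a * b')         ∎
    where
    cross : b' * b' + g * (a * b') ≈ (w * (b * b) + g * (b * b)) + b * b''
    cross = begin
      b' * b' + g * (a * b')  ≈⟨ solve 3 (λ B' G A → B' :* B' :+ G :* (A :* B') := (B' :+ G :* A) :* B') refl b' g a ⟩
      (b' + g * a) * b'       ≈⟨ *-congʳ b'-rec ⟩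
      x * b * b'              ≈⟨ solve 3 (λ X B B' → X :* B :* B' := B :* (X :* B')) refl x b b' ⟩
      b * (x * b')            ≈⟨ *-congˡ b''-rec ⟨
      b * (b'' + g' * b)      ≈⟨ *-congˡ (+-congˡ (*-congʳ g'≈g+w)) ⟩
      b * (b'' + (g + w) * b) ≈⟨ solve 4 (λ B B'' G W → B :* (B'' :+ (G :+ W) :* B)
                                                := W :* (B :* B) :+ G :* (B :* B) :+ B :* B'') refl b b'' g w ⟩
      w * (b * b) + g * (b * b) + b * b'' ∎

  sumTo-cong : ∀ n {f h : ℕ → Carrier} → (∀ k → suc k ≤ n → f k ≈ h k) → sumTo n f ≈ sumTo n h
  sumTo-cong zero    f≈h = refl
  sumTo-cong (suc n) f≈h =
    +-cong (sumTo-cong n (λ k k<n → f≈h k (ℕP.m≤n⇒m≤1+n k<n))) (f≈h n ℕP.≤-refl)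

  sumTo-*ʳ : ∀ n f z → sumTo n f * z ≈ sumTo n (λ k → f k * z)
  sumTo-*ʳ zero    f z = zeroˡ z
  sumTo-*ʳ (suc n) f z = trans (distribʳ z _ _) (+-congʳ (sumTo-*ʳ n f z))

  prodFrom-suc : ∀ a m g → prodFrom a (suc m) g ≈ prodFrom a m g * g (suc (a ℕ.+ m))
  prodFrom-suc a zero    g rewrite ℕP.+-identityʳ a = *-comm _ _
  prodFrom-suc a (suc m) g = begin
    g (suc a) * prodFrom (suc a) (suc m) g                     ≈⟨ *-congˡ (prodFrom-suc (suc a) m g) ⟩
    g (suc a) * (prodFrom (suc a) m g * g (suc (suc a ℕ.+ m))) ≈⟨ *-assoc _ _ _ ⟨
    prodFrom a (suc m) g * g (suc (suc a ℕ.+ m))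
      ≡⟨ P.cong (λ t → prodFrom a (suc m) g * g (suc t)) (ℕP.+-suc a m) ⟨
    prodFrom a (suc m) g * g (suc (a ℕ.+ suc m))              ∎

  prodIoc-suc : ∀ {k n} g → k ≤ n → prodIoc k (suc n) g ≈ prodIoc k n g * g (suc n)
  prodIoc-suc {k} {n} g k≤n rewrite ℕP.+-∸-assoc 1 k≤n =
    trans (prodFrom-suc k (n ∸ k) g) (*-congˡ (reflexive (P.cong (λ t → g (suc t)) (ℕP.m+[n∸m]≡n k≤n))))

  prodIoc-self-suc : ∀ n g → prodIoc n (suc n) g ≈ g (suc n)
  prodIoc-self-suc n g rewrite ℕP.m+n∸n≡m 1 n = *-identityʳ (g (suc n))

  sumTo-prodIoc-unroll : ∀ (e q g T : ℕ → Carrier) → g 0 ≈ 0# →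
    (∀ n → T (suc n) ≈ e n * q n + g n * T n) →
    ∀ n → sumTo n (λ k → e k * prodIoc k n g * q k) ≈ g n * T n
  sumTo-prodIoc-unroll e q g T g0≈0 T-suc zero = sym (trans (*-congʳ g0≈0) (zeroˡ (T 0)))
  sumTo-prodIoc-unroll e q g T g0≈0 T-suc (suc n) = begin
    sumTo n (λ k → e k * prodIoc k (suc n) g * q k) + e n * prodIoc n (suc n) g * q n
      ≈⟨ +-cong (sumTo-cong n (λ k k<n → move-last (prodIoc-suc g (ℕP.<⇒≤ k<n))))
                (*-congʳ (*-congˡ (prodIoc-self-suc n g))) ⟩
    sumTo n (λ k → e k * prodIoc k n g * q k * g (suc n)) + e n * g (suc n) * q n
      ≈⟨ +-congʳ (sumTo-*ʳ n _ (g (suc n))) ⟨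
    sumTo n (λ k → e k * prodIoc k n g * q k) * g (suc n) + e n * g (suc n) * q n
      ≈⟨ +-congʳ (*-congʳ (sumTo-prodIoc-unroll e q g T g0≈0 T-suc n)) ⟩
    g n * T n * g (suc n) + e n * g (suc n) * q n
      ≈⟨ solve 5 (λ Tn G G' E Q → G :* Tn :* G' :+ E :* G' :* Q := G' :* (E :* Q :+ G :* Tn))
               refl (T n) (g n) (g (suc n)) (e n) (q n) ⟩
    g (suc n) * (e n * q n + g n * T n)
      ≈⟨ *-congˡ (T-suc n) ⟨
    g (suc n) * T (suc n) ∎
    where
    move-last : ∀ {k u v} → u ≈ v * g (suc n) → e k * u * q k ≈ e k * v * q k * g (suc n)
    move-last {k} {u} {v} u≈v*g = trans (*-congʳ (*-congˡ u≈v*g))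
      (solve 4 (λ E V G Q → E :* (V :* G) :* Q := E :* V :* Q :* G) refl (e k) v (g (suc n)) (q k))

module DPolyProperties {c ℓ} (R : CommutativeRing c ℓ) where
  open CommutativeRing R
  open DPoly R
  open CommutativeRingProperties R
  open import Algebra.Properties.Ring ring using (//-rightDividesˡ)
  open import Algebra.Solver.Ring.NaturalCoefficients.Default commutativeSemiring

  module _ (r x : Carrier) where
    γ : ℕ → Carrier
    γ n = ι n * (ι n + (r + r))

    Dprev : ℕ → Carrier
    Dprev n = proj₁ (Dpair r x n)

    turán : ℕ → Carrier
    turán n = D r x n * D r x n - Dprev n * D r x (suc n)

    γ-zero : γ 0 ≈ 0#
    γ-zero = zeroˡ (0# + (r + r))

    γ-suc : ∀ n → γ (suc n) ≈ γ n + (ι (2 ℕ.* n) + (r + r) + 1#)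
    γ-suc n = trans
      (solve 2 (λ N Rr → (con 1 :+ N) :* ((con 1 :+ N) :+ (Rr :+ Rr))
                         := N :* (N :+ (Rr :+ Rr)) :+ (N :+ N :+ (Rr :+ Rr) :+ con 1)) refl (ι n) r)
      (+-congˡ (+-congʳ (+-congʳ (sym (ι-2* n)))))

    D-suc : ∀ n → D r x (suc n) + γ n * Dprev n ≈ x * D r x n
    D-suc n = //-rightDividesˡ (γ n * Dprev n) (x * D r x n)

    turán-suc : ∀ n → turán (suc n) ≈ (ι (2 ℕ.* n) + (r + r) + 1#) * (D r x n * D r x n) + γ n * turán n
    turán-suc n = turán-step (D-suc n) (D-suc (suc n)) (γ-suc n)

    sumTo-weighted-D²≈γ*turán : ∀ n →
      sumTo n (λ k → (ι (2 ℕ.* k) + (r + r) + 1#) * prodIoc k n γ * (D r x k * D r x k)) ≈ γ n * turán n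
    sumTo-weighted-D²≈γ*turán = sumTo-prodIoc-unroll _ (λ k → D r x k * D r x k) γ turán γ-zero turán-suc

module OrderedCommRingProperties {c ℓ ℓ'} (R : CommutativeRing c ℓ)
  (_<_ : Rel (CommutativeRing.Carrier R) ℓ') (ordered : IsOrderedCommRing R _<_) where
  open CommutativeRing R
  open DPoly R
  open IsOrderedCommRing ordered
  open IsStrictTotalOrder isStrictTotalOrder public using (<-respʳ-≈)
  open IsStrictTotalOrder isStrictTotalOrder using (<-respˡ-≈; compare) renaming (trans to <-trans)
  open StrictToNonStrict _≈_ _<_ public using () renaming (_≤_ to _≼_)
  open import Algebra.Properties.Ring ring using (-‿distribˡ-*; -‿distribʳ-*; -‿involutive)

  +-pos-nonneg : ∀ {u v} → 0# < u → 0# ≼ v → 0# < (u + v)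
  +-pos-nonneg {u} {v} 0<u (inj₁ 0<v) =
    <-trans 0<u (<-respʳ-≈ (+-comm v u) (<-respˡ-≈ (+-identityˡ u) (+-monoˡ-< u 0<v)))
  +-pos-nonneg {u} {v} 0<u (inj₂ 0≈v) = <-respʳ-≈ (trans (sym (+-identityʳ u)) (+-congˡ 0≈v)) 0<u

  +-nonneg-pos : ∀ {u v} → 0# ≼ u → 0# < v → 0# < (u + v)
  +-nonneg-pos 0≼u 0<v = <-respʳ-≈ (+-comm _ _) (+-pos-nonneg 0<v 0≼u)

  *-pos-nonneg : ∀ {u v} → 0# < u → 0# ≼ v → 0# ≼ (u * v)
  *-pos-nonneg     0<u (inj₁ 0<v) = inj₁ (*-pos 0<u 0<v)
  *-pos-nonneg {u} 0<u (inj₂ 0≈v) = inj₂ (sym (trans (*-congˡ (sym 0≈v)) (zeroʳ u)))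

  x<0⇒0<-x : ∀ {u} → u < 0# → 0# < (- u)
  x<0⇒0<-x {u} u<0 = <-respʳ-≈ (+-identityˡ (- u)) (<-respˡ-≈ (-‿inverseʳ u) (+-monoˡ-< (- u) u<0))

  square-nonneg : ∀ u → 0# ≼ (u * u)
  square-nonneg u with compare 0# u
  ... | tri< 0<u _ _ = inj₁ (*-pos 0<u 0<u)
  ... | tri≈ _ 0≈u _ = inj₂ (sym (trans (*-congˡ (sym 0≈u)) (zeroʳ u)))
  ... | tri> _ _ u<0 = inj₁ (<-respʳ-≈ -u*-u≈u*u (*-pos (x<0⇒0<-x u<0) (x<0⇒0<-x u<0)))
    where
    -u*-u≈u*u : - u * - u ≈ u * u
    -u*-u≈u*u = trans (sym (-‿distribˡ-* u (- u)))
                      (trans (-‿cong (sym (-‿distribʳ-* u u))) (-‿involutive (u * u)))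

  ι-nonneg : ∀ n → 0# ≼ ι n
  ι-nonneg zero    = inj₂ refl
  ι-nonneg (suc n) = inj₁ (+-pos-nonneg 0<1 (ι-nonneg n))

module DPolyPositivity {c ℓ ℓ'} (R : CommutativeRing c ℓ)
  (_<_ : Rel (CommutativeRing.Carrier R) ℓ') (ordered : IsOrderedCommRing R _<_) where
  open CommutativeRing R
  open DPoly R
  open IsOrderedCommRing ordered
  open OrderedCommRingProperties R _<_ ordered
  open DPolyProperties R using (γ; turán; γ-zero; turán-suc)
  open import Algebra.Solver.Ring.NaturalCoefficients.Default commutativeSemiring

  module _ (r : Carrier) (0<2r+1 : 0# < (r + r + 1#)) (x : Carrier) where
    ι-+-2r+1-pos : ∀ n → 0# < (ι n + (r + r + 1#))
    ι-+-2r+1-pos n = +-nonneg-pos (ι-nonneg n) 0<2r+1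

    γ-suc-pos : ∀ n → 0# < γ r x (suc n)
    γ-suc-pos n = *-pos (+-pos-nonneg 0<1 (ι-nonneg n))
      (<-respʳ-≈ (solve 2 (λ N Rr → N :+ (Rr :+ Rr :+ con 1) := con 1 :+ N :+ (Rr :+ Rr)) refl (ι n) r)
                 (ι-+-2r+1-pos n))

    weight-pos : ∀ n → 0# < (ι (2 ℕ.* n) + (r + r) + 1#)
    weight-pos n = <-respʳ-≈ (sym (+-assoc _ _ _)) (ι-+-2r+1-pos (2 ℕ.* n))

    turán-suc-pos : ∀ n → 0# < turán r x (suc n)
    turán-suc-pos zero = <-respʳ-≈ (sym (turán-suc r x 0))
      (+-pos-nonneg (*-pos (weight-pos 0) (*-pos 0<1 0<1))
                    (inj₂ (sym (trans (*-congʳ (γ-zero r x)) (zeroˡ _)))))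
    turán-suc-pos (suc n) = <-respʳ-≈ (sym (turán-suc r x (suc n)))
      (+-nonneg-pos (*-pos-nonneg (weight-pos (suc n)) (square-nonneg _))
                    (*-pos (γ-suc-pos n) (turán-suc-pos n)))

theorem3p1 : ∀ {c ℓ ℓ' : Level} →
    ((R : CommutativeRing c ℓ) → let open CommutativeRing R in let open DPoly R in
      ∀ (r x : Carrier) (n : ℕ) → 1 ≤ n →
        sumTo n (λ k → (ι (2 ℕ.* k) + (r + r) + 1#)
                         * prodIoc k n (λ s → ι s * (ι s + (r + r)))
                         * (D r x k * D r x k))
        ≈ (ι n * (ι n + (r + r)))
            * (D r x n * D r x n - D r x (n ∸ 1) * D r x (suc n)))
    ×
    ((R : CommutativeRing c ℓ) (_<_ : Rel (CommutativeRing.Carrier R) ℓ') →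
      IsOrderedCommRing R _<_ →
      let open CommutativeRing R in let open DPoly R in
      ∀ (r : Carrier) → 0# < (r + r + 1#) →
      ∀ (x : Carrier) (n : ℕ) → 1 ≤ n →
        0# < (D r x n * D r x n - D r x (suc n) * D r x (n ∸ 1)))
theorem3p1 =
    (λ { R r x (suc n) _ → DPolyProperties.sumTo-weighted-D²≈γ*turán R r x (suc n) })
  , (λ { R _<_ ordered r 0<2r+1 x (suc n) _ →
         let open CommutativeRing R
             open OrderedCommRingProperties R _<_ ordered
             open DPolyPositivity R _<_ ordered
         in <-respʳ-≈ (+-congˡ (-‿cong (*-comm _ _))) (turán-suc-pos r 0<2r+1 x n) })
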